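{- Let $H$ and $G$ be finite graphs with $H\le G$ in $\mathcal{G}$ and $|G|-|H|>2$. Then the interval $[H,G]$ of $\mathcal{G}$ is disconnected if and only if it is strongly zero-split.
   Context: $\mathcal{G}$ is the poset of all finite unlabelled graphs (loops and multiple edges allowed), taken up to isomorphism, with $H\le G$ if and only if $H$ is isomorphic to an induced subgraph of $G$; $|G|$ denotes the number of vertices of $G$. For $x\le y$ the interval is $[x,y]=\{z: x\le z\le y\}$ and its interior is $(x,y)=[x,y]\setminus\{x,y\}$. The interval $[x,y]$ is disconnected if $(x,y)$ can be partitioned into two non-empty sets $A,B$ such that no element of $A$ is comparable to any element of $B$. Occurrences: label the vertices of $G$ arbitrarily by $[|G|]=\{1,\dots,|G|\}$; for $\eta\subseteq[|G|]$ let $G[\eta]$ be the induced subgraph on $\eta$; $\eta$ is an occurrence of $H$ in $G$ if $G[\eta]\cong H$, and $E(H,G)$ is the set of all occurrences of $H$ in $G$. For $\eta\in E(H,G)$ put $Z(\eta)=[|G|]\setminus\eta$, and for $A\subseteq E(H,G)$ put $Z(A)=\bigcup_{\eta\in A}Z(\eta)$. The interval $[H,G]$ is zero-split if $E(H,G)$ can be partitioned into two non-empty disjoint sets $A,B$ with $Z(A)\cap Z(B)=\emptyset$ (a zero-split partition). It is strongly zero-split if there is a zero-split partition $A,B$ such that there do not exist $\eta\in A$, $\phi\in B$, $i\in[|G|]\setminus\eta$ and $j\in[|G|]\setminus\phi$ with $G[\eta\cup\{i\}]\cong G[\phi\cup\{j\}]$. -}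

module Defs where

open import Data.Nat using (ℕ; _+_; _<_)
open import Data.Fin using (Fin)
open import Data.Fin.Subset using (Subset; _∈_; _∉_; _∪_; ⁅_⁆)
open import Data.Bool using (Bool; true; false)
open import Data.Product using (Σ; ∃; ∃-syntax; _×_; _,_; proj₁)
open import Relation.Binary.PropositionalEquality using (_≡_)
open import Relation.Nullary using (¬_)
open import Data.Empty using (⊥)

-- A finite graph on vertex set Fin n, loops and multiple edges allowed:
-- adj i j is the number of edges between i and j (adj i i = number of loops at i).
record Graph (n : ℕ) : Set where
  field
    adj : Fin n → Fin n → ℕ
    sym : ∀ i j → adj i j ≡ adj j i
open Graph public

Gr : Set
Gr = Σ ℕ Graph

∣_∣ᵍ : Gr → ℕ
∣ G ∣ᵍ = proj₁ G

adjOf : (G : Gr) → Fin (proj₁ G) → Fin (proj₁ G) → ℕ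
adjOf (_ , G) = adj G

-- Graph isomorphism (equality in the poset 𝒢 of isomorphism classes).
record _≅_ (H G : Gr) : Set where
  field
    to      : Fin ∣ H ∣ᵍ → Fin ∣ G ∣ᵍ
    from    : Fin ∣ G ∣ᵍ → Fin ∣ H ∣ᵍ
    from-to : ∀ i → from (to i) ≡ i
    to-from : ∀ j → to (from j) ≡ j
    pres    : ∀ i j → adjOf H i j ≡ adjOf G (to i) (to j)

-- H ≤ G : H is isomorphic to an induced subgraph of G
-- (an injective vertex map preserving edge multiplicities).
_≼_ : Gr → Gr → Set
H ≼ G = Σ (Fin ∣ H ∣ᵍ → Fin ∣ G ∣ᵍ) λ f →
          (∀ i j → f i ≡ f j → i ≡ j) ×
          (∀ i j → adjOf H i j ≡ adjOf G (f i) (f j))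

InInterior : Gr → Gr → Gr → Set
InInterior H G Z = H ≼ Z × Z ≼ G × ¬ (Z ≅ H) × ¬ (Z ≅ G)

-- [H,G] is disconnected: the interior splits into two non-empty parts
-- (c = true / c = false) with no element of one comparable to one of the other.
Disconnected : Gr → Gr → Set
Disconnected H G =
  Σ (Gr → Bool) λ c →
    (∃[ a ] (InInterior H G a × c a ≡ true)) ×
    (∃[ b ] (InInterior H G b × c b ≡ false)) ×
    (∀ x y → InInterior H G x → InInterior H G y →
       c x ≡ true → c y ≡ false → ¬ (x ≼ y) × ¬ (y ≼ x))

-- η ⊆ [|G|] is an occurrence of H in G : G[η] ≅ H, i.e. there is an
-- isomorphism from H onto the induced subgraph of G on η.
Occ : (H G : Gr) → Subset ∣ G ∣ᵍ → Set
Occ H G η = Σ (Fin ∣ H ∣ᵍ → Fin ∣ G ∣ᵍ) λ f →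
  (∀ i → f i ∈ η) ×
  (∀ i j → f i ≡ f j → i ≡ j) ×
  (∀ v → v ∈ η → ∃[ i ] f i ≡ v) ×
  (∀ i j → adjOf H i j ≡ adjOf G (f i) (f j))

InducedIso : (G : Gr) → Subset ∣ G ∣ᵍ → Subset ∣ G ∣ᵍ → Set
InducedIso G S T = Σ (Fin ∣ G ∣ᵍ → Fin ∣ G ∣ᵍ) λ f →
  (∀ v → v ∈ S → f v ∈ T) ×
  (∀ u v → u ∈ S → v ∈ S → f u ≡ f v → u ≡ v) ×
  (∀ w → w ∈ T → ∃[ v ] (v ∈ S × f v ≡ w)) ×
  (∀ u v → u ∈ S → v ∈ S → adjOf G u v ≡ adjOf G (f u) (f v))

-- A zero-split partition of E(H,G): occurrences with c η = true form A,
-- those with c η = false form B; both non-empty, and Z(A) ∩ Z(B) = ∅.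
ZeroSplitPartition : (H G : Gr) → (Subset ∣ G ∣ᵍ → Bool) → Set
ZeroSplitPartition H G c =
  (∃[ η ] (Occ H G η × c η ≡ true)) ×
  (∃[ φ ] (Occ H G φ × c φ ≡ false)) ×
  (∀ η φ v → Occ H G η → Occ H G φ → c η ≡ true → c φ ≡ false →
     v ∉ η → v ∉ φ → ⊥)

ZeroSplit : Gr → Gr → Set
ZeroSplit H G = Σ (Subset ∣ G ∣ᵍ → Bool) (ZeroSplitPartition H G)

StronglyZeroSplit : Gr → Gr → Set
StronglyZeroSplit H G =
  Σ (Subset ∣ G ∣ᵍ → Bool) λ c →
    ZeroSplitPartition H G c ×
    (∀ η φ i j → Occ H G η → Occ H G φ → c η ≡ true → c φ ≡ false →
       i ∉ η → j ∉ φ → ¬ InducedIso G (η ∪ ⁅ i ⁆) (φ ∪ ⁅ j ⁆))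

-- A disconnection of the interior is a two-colouring constant on comparable pairs. It induces a
-- colouring of the occurrences η of H: colour η like G − v for any v ∉ η. This does not depend
-- on v, since G − u and G − w both contain G[η ∪ {i}] for a vertex i ∉ η ∪ {u, w} (this is where
-- |G| − |H| > 2 is needed). Hence η also has the colour of each extension G[η ∪ {i}], and every
-- interior element, containing such an extension, has the colour of some occurrence; occurrences
-- sharing an absent vertex, or having isomorphic extensions, get the same colour.
-- Conversely, colour an interior element K by the colour of the occurrence g (h H) for embeddings
-- h : H → K and g : K → G. Changing h keeps every vertex outside g K absent from both occurrences;
-- changing g, while keeping h, produces occurrences whose extensions by the image of a vertex of
-- K outside h H are isomorphic. So the colour is well defined and constant along ≤.

module Submission where

open import Defs
open import Data.Nat using (_+_; _<_)
open import Function.Bundles using (_⇔_; mk⇔)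

open import Data.Nat using (ℕ; zero; suc; _≤_)
import Data.Nat.Properties as ℕ
open import Data.Bool using (Bool; true; false)
import Data.Bool.Properties as Bool
open import Data.Empty using (⊥; ⊥-elim)
open import Data.Fin as Fin using (Fin; zero; suc; punchIn; punchOut)
open import Data.Fin.Properties
  using (any?; all?; ¬∀⟶∃¬; injective⇒≤; suc-injective; punchIn-injective; punchIn-punchOut)
open import Data.Fin.Subset using (Subset; _∈_; _∉_; _∪_; ⁅_⁆) renaming (⊥ to ∅)
open import Data.Fin.Subset.Properties
  using (_∈?_; ∉⊥; ⊆-antisym; x∈p∪q⁺; x∈p∪q⁻; x∈⁅x⁆; x∈⁅y⁆⇒x≡y)
open import Data.Product using (Σ; ∃; ∃-syntax; _×_; _,_; proj₁; proj₂; map₂)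
open import Data.Sum using (_⊎_; inj₁; inj₂)
open import Data.Vec.Functional using (_∷_; head; tail)
open import Data.Vec.Functional.Properties using (∷-cong)
open import Function using (_∘_)
open import Relation.Nullary using (¬_; Dec; yes; no; does)
open import Relation.Nullary.Decidable using (map′; ¬?; _×-dec_; _→-dec_)
open import Relation.Binary.PropositionalEquality as ≡
  using (_≡_; _≢_; _≗_; refl; trans; cong; cong₂; ≢-sym)

Injective : ∀ {a b} → (Fin a → Fin b) → Set
Injective f = ∀ i j → f i ≡ f j → i ≡ j

Surjective : ∀ {a b} → (Fin a → Fin b) → Set
Surjective f = ∀ u → ∃ λ x → f x ≡ u

Misses : ∀ {a b} → (Fin a → Fin b) → Fin b → Set
Misses f u = ∀ x → f x ≢ u

injective-∘ : ∀ {a b c} {g : Fin b → Fin c} {f : Fin a → Fin b} →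
              Injective g → Injective f → Injective (g ∘ f)
injective-∘ g-inj f-inj i j eq = f-inj i j (g-inj _ _ eq)

injective-∷ : ∀ {a b} {i : Fin b} {f : Fin a → Fin b} →
              Injective f → Misses f i → Injective (i ∷ f)
injective-∷ f-inj i∉f zero    zero    _  = refl
injective-∷ f-inj i∉f zero    (suc y) eq = ⊥-elim (i∉f y (≡.sym eq))
injective-∷ f-inj i∉f (suc x) zero    eq = ⊥-elim (i∉f x eq)
injective-∷ f-inj i∉f (suc x) (suc y) eq = cong suc (f-inj x y eq)

misses-∷ : ∀ {a b} {i u : Fin b} {f : Fin a → Fin b} → i ≢ u → Misses f u → Misses (i ∷ f) u
misses-∷ i≢u u∉f zero    = i≢u
misses-∷ i≢u u∉f (suc x) = u∉f x

misses-∘ : ∀ {a b c} {g : Fin b → Fin c} {h : Fin a → Fin b} {x} →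
           Injective g → Misses h x → Misses (g ∘ h) (g x)
misses-∘ g-inj x∉h y eq = x∉h y (g-inj _ _ eq)

preimage? : ∀ {a b} (f : Fin a → Fin b) u → Dec (∃ λ x → f x ≡ u)
preimage? f u = any? (λ x → f x Fin.≟ u)

misses⊎surjective : ∀ {a b} (f : Fin a → Fin b) → ∃ (Misses f) ⊎ Surjective f
misses⊎surjective f with all? (preimage? f)
... | yes surj = inj₂ surj
... | no ¬surj = inj₁ (map₂ (λ ¬hit x fx≡u → ¬hit (x , fx≡u)) (¬∀⟶∃¬ _ _ (preimage? f) ¬surj))

surjective⇒≤ : ∀ {a b} {f : Fin a → Fin b} → Surjective f → b ≤ a
surjective⇒≤ {f = f} surj = injective⇒≤ λ {u} {v} eq →
  trans (≡.sym (proj₂ (surj u))) (trans (cong f eq) (proj₂ (surj v)))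

<⇒misses : ∀ {a b} → a < b → (f : Fin a → Fin b) → ∃ (Misses f)
<⇒misses a<b f with misses⊎surjective f
... | inj₁ missed = missed
... | inj₂ surj   = ⊥-elim (ℕ.<⇒≱ a<b (surjective⇒≤ surj))

anyFunction? : ∀ a {b} {P : (Fin a → Fin b) → Set} →
               (∀ {f g} → f ≗ g → P f → P g) → (∀ f → Dec (P f)) → Dec (∃ P)
anyFunction? zero    resp P? = map′ (λ p → _ , p) (λ (f , p) → resp (λ ()) p) (P? (λ ()))
anyFunction? (suc a) resp P? =
  map′ (λ (i , f , p) → i ∷ f , p)
       (λ (f , p) → head f , tail f , resp (∷-cong refl (λ _ → refl)) p)
       (any? λ i → anyFunction? a (λ eq → resp (∷-cong refl eq)) (λ f → P? (i ∷ f)))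

image : ∀ {a b} → (Fin a → Fin b) → Subset b
image {zero}  f = ∅
image {suc a} f = image (tail f) ∪ ⁅ head f ⁆

image-cong : ∀ {a b} {f g : Fin a → Fin b} → f ≗ g → image f ≡ image g
image-cong {zero}  eq = refl
image-cong {suc a} eq = cong₂ (λ p x → p ∪ ⁅ x ⁆) (image-cong (eq ∘ suc)) (eq zero)

Enumerates : ∀ {a b} → (Fin a → Fin b) → Subset b → Set
Enumerates f S = (∀ x → f x ∈ S) × (∀ v → v ∈ S → ∃ λ x → f x ≡ v)

image-enumerates : ∀ {a b} (f : Fin a → Fin b) → Enumerates f (image f)
image-enumerates f = ∈-image f , λ _ → image-∈ f
  where
  ∈-image : ∀ {a b} (f : Fin a → Fin b) x → f x ∈ image f
  ∈-image f zero    = x∈p∪q⁺ (inj₂ (x∈⁅x⁆ (f zero)))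
  ∈-image f (suc x) = x∈p∪q⁺ (inj₁ (∈-image (tail f) x))

  image-∈ : ∀ {a b} (f : Fin a → Fin b) {v} → v ∈ image f → ∃ λ x → f x ≡ v
  image-∈ {zero}  f v∈ = ⊥-elim (∉⊥ v∈)
  image-∈ {suc a} f v∈ with x∈p∪q⁻ (image (tail f)) ⁅ head f ⁆ v∈
  ... | inj₁ v∈tail = let x , eq = image-∈ (tail f) v∈tail in suc x , eq
  ... | inj₂ v∈head = zero , ≡.sym (x∈⁅y⁆⇒x≡y (f zero) v∈head)

enumerates⇒image≡ : ∀ {a b} {f : Fin a → Fin b} {S} → Enumerates f S → image f ≡ S
enumerates⇒image≡ {f = f} {S} (f∈S , onto) = ⊆-antisym
  (λ v∈ → let x , eq = proj₂ (image-enumerates f) _ v∈ in ≡.subst (_∈ S) eq (f∈S x))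
  (λ v∈ → let x , eq = onto _ v∈ in ≡.subst (_∈ image f) eq (proj₁ (image-enumerates f) x))

∷-enumerates : ∀ {a b} {f : Fin a → Fin b} {S i} → Enumerates f S → Enumerates (i ∷ f) (S ∪ ⁅ i ⁆)
∷-enumerates {f = f} {S} {i} (f∈S , onto) = ∈S∪i , onto∪i
  where
  ∈S∪i : ∀ x → (i ∷ f) x ∈ S ∪ ⁅ i ⁆
  ∈S∪i zero    = x∈p∪q⁺ (inj₂ (x∈⁅x⁆ i))
  ∈S∪i (suc x) = x∈p∪q⁺ (inj₁ (f∈S x))

  onto∪i : ∀ v → v ∈ S ∪ ⁅ i ⁆ → ∃ λ x → (i ∷ f) x ≡ v
  onto∪i v v∈ with x∈p∪q⁻ S ⁅ i ⁆ v∈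
  ... | inj₁ v∈S = let x , eq = onto v v∈S in suc x , eq
  ... | inj₂ v≡i = zero , ≡.sym (x∈⁅y⁆⇒x≡y i v≡i)

∉⇒misses : ∀ {a b} {f : Fin a → Fin b} {S u} → Enumerates f S → u ∉ S → Misses f u
∉⇒misses (f∈S , _) u∉S x eq = u∉S (≡.subst (_∈ _) eq (f∈S x))

misses⇒∉ : ∀ {a b} {f : Fin a → Fin b} {S u} → Enumerates f S → Misses f u → u ∉ S
misses⇒∉ (_ , onto) u∉f u∈S = let x , eq = onto _ u∈S in u∉f x eq

-- Embeddings and induced subgraphs

Emb : (X Y : Gr) → (Fin ∣ X ∣ᵍ → Fin ∣ Y ∣ᵍ) → Set
Emb X Y f = Injective f × (∀ i j → adjOf X i j ≡ adjOf Y (f i) (f j))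

emb-∘ : ∀ {X Y Z g f} → Emb Y Z g → Emb X Y f → Emb X Z (g ∘ f)
emb-∘ {f = f} (g-inj , g-adj) (f-inj , f-adj) =
  injective-∘ g-inj f-inj , λ i j → trans (f-adj i j) (g-adj (f i) (f j))

emb-resp : ∀ {X Y f g} → f ≗ g → Emb X Y f → Emb X Y g
emb-resp {Y = Y} eq (f-inj , f-adj) =
  (λ i j gi≡gj → f-inj i j (trans (eq i) (trans gi≡gj (≡.sym (eq j))))) ,
  (λ i j → trans (f-adj i j) (cong₂ (adjOf Y) (eq i) (eq j)))

emb? : ∀ X Y f → Dec (Emb X Y f)
emb? X Y f = all? (λ i → all? λ j → (f i Fin.≟ f j) →-dec (i Fin.≟ j))
       ×-dec all? (λ i → all? λ j → adjOf X i j ℕ.≟ adjOf Y (f i) (f j))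

≅⇒size≡ : ∀ {X Y} → X ≅ Y → ∣ X ∣ᵍ ≡ ∣ Y ∣ᵍ
≅⇒size≡ iso = ℕ.≤-antisym (injective⇒≤ (inverse⇒injective to from from-to))
                          (injective⇒≤ (inverse⇒injective from to to-from))
  where
  open _≅_ iso
  inverse⇒injective : ∀ {a b} (f : Fin a → Fin b) (g : Fin b → Fin a) → (∀ x → g (f x) ≡ x) →
                      ∀ {x y} → f x ≡ f y → x ≡ y
  inverse⇒injective f g gf≡id {x} {y} eq = trans (≡.sym (gf≡id x)) (trans (cong g eq) (gf≡id y))

≅-sym : ∀ {X Y} → X ≅ Y → Y ≅ X
≅-sym {X} {Y} iso = record
  { to = from ; from = to ; from-to = to-from ; to-from = from-to
  ; pres = λ i j → ≡.sym (trans (pres (from i) (from j)) (cong₂ (adjOf Y) (to-from i) (to-from j)))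
  }
  where open _≅_ iso

≇⇒misses : ∀ {X Y} (e : X ≼ Y) → ¬ X ≅ Y → ∃ (Misses (proj₁ e))
≇⇒misses (f , f-inj , f-adj) X≇Y with misses⊎surjective f
... | inj₁ missed = missed
... | inj₂ surj   = ⊥-elim (X≇Y record
  { to = f ; from = proj₁ ∘ surj
  ; from-to = λ i → f-inj _ _ (proj₂ (surj (f i))) ; to-from = proj₂ ∘ surj ; pres = f-adj })

infixl 30 _⟨_⟩
_⟨_⟩ : (G : Gr) {m : ℕ} → (Fin m → Fin ∣ G ∣ᵍ) → Gr
_⟨_⟩ G {m} e = m , record
  { adj = λ a b → adjOf G (e a) (e b) ; sym = λ a b → Graph.sym (proj₂ G) (e a) (e b) }

induced-emb : ∀ G {m} {e : Fin m → Fin ∣ G ∣ᵍ} → Injective e → Emb (G ⟨ e ⟩) G e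
induced-emb G e-inj = e-inj , λ _ _ → refl

≼-induced : ∀ {X} G {f m} {e : Fin m → Fin ∣ G ∣ᵍ} → Emb X G f → Injective e →
            (∀ x → ∃ λ y → e y ≡ f x) → X ≼ G ⟨ e ⟩
≼-induced {X} G {f} {m} {e} (f-inj , f-adj) e-inj factor = d , d-inj , d-adj
  where
  d : Fin ∣ X ∣ᵍ → Fin m
  d = proj₁ ∘ factor
  d-inj : Injective d
  d-inj i j eq = f-inj i j (trans (≡.sym (proj₂ (factor i))) (trans (cong e eq) (proj₂ (factor j))))
  d-adj : ∀ i j → adjOf X i j ≡ adjOf G (e (d i)) (e (d j))
  d-adj i j = trans (f-adj i j)
                    (cong₂ (adjOf G) (≡.sym (proj₂ (factor i))) (≡.sym (proj₂ (factor j))))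

induced-≼ : ∀ {X} G {m g} {d : Fin m → Fin ∣ X ∣ᵍ} {e : Fin m → Fin ∣ G ∣ᵍ} →
            Emb X G g → Injective d → e ≗ g ∘ d → G ⟨ e ⟩ ≼ X
induced-≼ G {d = d} (_ , g-adj) d-inj e≗gd =
  d , d-inj , λ p q → trans (cong₂ (adjOf G) (e≗gd p) (e≗gd q)) (≡.sym (g-adj (d p) (d q)))

suc-emb : ∀ {H} G {f i} → Emb H G f → Emb H (G ⟨ i ∷ f ⟩) suc
suc-emb G (_ , f-adj) = (λ _ _ → suc-injective) , f-adj

extension-interior : ∀ {H} G {f i} → suc ∣ H ∣ᵍ < ∣ G ∣ᵍ → Emb H G f → Misses f i →
                     InInterior H G (G ⟨ i ∷ f ⟩)
extension-interior {H} G {f} {i} 1+k<n f-emb i∉f =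
  (suc , suc-emb {H} G {f} {i} f-emb) , (i ∷ f , induced-emb G (injective-∷ (proj₁ f-emb) i∉f)) ,
  ℕ.1+n≢n ∘ ≅⇒size≡ , ℕ.<⇒≢ 1+k<n ∘ ≅⇒size≡

module Occurrences (H G : Gr) where

  occ-emb : ∀ {η} (o : Occ H G η) → Emb H G (proj₁ o)
  occ-emb (_ , _ , f-inj , _ , f-adj) = f-inj , f-adj

  occ-enumerates : ∀ {η} (o : Occ H G η) → Enumerates (proj₁ o) η
  occ-enumerates (_ , f∈η , _ , onto , _) = f∈η , onto

  image-occ : ∀ {f} → Emb H G f → Occ H G (image f)
  image-occ {f} (f-inj , f-adj) =
    f , proj₁ (image-enumerates f) , f-inj , proj₂ (image-enumerates f) , f-adj

InducedIso⇒≼ : ∀ G {a b S T} {e₁ : Fin a → Fin ∣ G ∣ᵍ} {e₂ : Fin b → Fin ∣ G ∣ᵍ} →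
               Enumerates e₁ S → Injective e₁ → Enumerates e₂ T → Injective e₂ →
               InducedIso G S T → G ⟨ e₁ ⟩ ≼ G ⟨ e₂ ⟩
InducedIso⇒≼ G {e₁ = e₁} (e₁∈S , _) e₁-inj (_ , onto) e₂-inj (σ , σ∈T , σ-inj , _ , σ-adj) =
  ≼-induced {G ⟨ e₁ ⟩} G σe₁-emb e₂-inj (λ x → onto _ (σ∈T _ (e₁∈S x)))
  where
  σe₁-emb : Emb (G ⟨ e₁ ⟩) G (σ ∘ e₁)
  σe₁-emb = (λ x y eq → e₁-inj x y (σ-inj _ _ (e₁∈S x) (e₁∈S y) eq))
          , (λ x y → σ-adj _ _ (e₁∈S x) (e₁∈S y))

sameInduced⇒InducedIso : ∀ G {a} {e₁ e₂ : Fin a → Fin ∣ G ∣ᵍ} → Injective e₁ → Injective e₂ →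
                         (∀ x y → adjOf G (e₁ x) (e₁ y) ≡ adjOf G (e₂ x) (e₂ y)) →
                         InducedIso G (image e₁) (image e₂)
sameInduced⇒InducedIso G {e₁ = e₁} {e₂} e₁-inj e₂-inj same-adj =
  σ , σ-into , σ-inj , σ-onto , σ-adj
  where
  σ : Fin ∣ G ∣ᵍ → Fin ∣ G ∣ᵍ
  σ v with any? (λ x → e₁ x Fin.≟ v)
  ... | yes (x , _) = e₂ x
  ... | no _        = v

  σe₁ : ∀ x → σ (e₁ x) ≡ e₂ x
  σe₁ x with any? (λ y → e₁ y Fin.≟ e₁ x)
  ... | yes (y , eq) = cong e₂ (e₁-inj _ _ eq)
  ... | no ¬hit      = ⊥-elim (¬hit (x , refl))

  open Σ (image-enumerates e₁) renaming (proj₁ to e₁∈ ; proj₂ to e₁-onto)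
  open Σ (image-enumerates e₂) renaming (proj₁ to e₂∈ ; proj₂ to e₂-onto)

  σ-into : ∀ v → v ∈ image e₁ → σ v ∈ image e₂
  σ-into v v∈ with e₁-onto v v∈
  ... | x , refl = ≡.subst (_∈ image e₂) (≡.sym (σe₁ x)) (e₂∈ x)

  σ-inj : ∀ u v → u ∈ image e₁ → v ∈ image e₁ → σ u ≡ σ v → u ≡ v
  σ-inj u v u∈ v∈ eq with e₁-onto u u∈ | e₁-onto v v∈
  ... | x , refl | y , refl = cong e₁ (e₂-inj x y (trans (≡.sym (σe₁ x)) (trans eq (σe₁ y))))

  σ-onto : ∀ w → w ∈ image e₂ → ∃ λ v → v ∈ image e₁ × σ v ≡ w
  σ-onto w w∈ with e₂-onto w w∈
  ... | x , refl = e₁ x , e₁∈ x , σe₁ x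

  σ-adj : ∀ u v → u ∈ image e₁ → v ∈ image e₁ → adjOf G u v ≡ adjOf G (σ u) (σ v)
  σ-adj u v u∈ v∈ with e₁-onto u u∈ | e₁-onto v v∈
  ... | x , refl | y , refl = trans (same-adj x y) (cong₂ (adjOf G) (≡.sym (σe₁ x)) (≡.sym (σe₁ y)))

≡⇒¬true-false : ∀ {a b : Bool} → a ≡ b → a ≡ true → b ≡ false → ⊥
≡⇒¬true-false refl refl ()

≡-unless-true-false : ∀ {a b : Bool} →
                      (a ≡ true → b ≡ false → ⊥) → (b ≡ true → a ≡ false → ⊥) → a ≡ b
≡-unless-true-false {true}  {true}  _ _ = refl
≡-unless-true-false {false} {false} _ _ = refl
≡-unless-true-false {true}  {false} p _ = ⊥-elim (p refl refl)
≡-unless-true-false {false} {true}  _ q = ⊥-elim (q refl refl)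

-- From a disconnected interval to a strongly zero-split one

module _ (H : Gr) {m : ℕ} (g : Graph (suc m)) (k+2<n : ∣ H ∣ᵍ + 2 < suc m) where

  private
    G : Gr
    G = suc m , g

    2+k<n : suc (suc ∣ H ∣ᵍ) < suc m
    2+k<n = ≡.subst (_< suc m) (ℕ.+-comm ∣ H ∣ᵍ 2) k+2<n

    1+k<n : suc ∣ H ∣ᵍ < suc m
    1+k<n = ℕ.<-trans (ℕ.n<1+n _) 2+k<n

  open Occurrences H G

  deleted : Fin (suc m) → Gr
  deleted v = G ⟨ punchIn v ⟩

  ≼-deleted : ∀ {X f v} → Emb X G f → Misses f v → X ≼ deleted v
  ≼-deleted {X} {v = v} f-emb v∉f =
    ≼-induced {X} G f-emb (punchIn-injective v) λ x → punchOut (≢-sym (v∉f x)) , punchIn-punchOut _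

  deleted-interior : ∀ {f v} → Emb H G f → Misses f v → InInterior H G (deleted v)
  deleted-interior {v = v} f-emb v∉f =
    ≼-deleted {H} f-emb v∉f , (punchIn v , induced-emb G (punchIn-injective v)) ,
    ℕ.<⇒≢ (ℕ.≤-pred 1+k<n) ∘ ≡.sym ∘ ≅⇒size≡ , ℕ.1+n≢n ∘ ≡.sym ∘ ≅⇒size≡

  outside : Subset (suc m) → Fin (suc m)
  outside η with any? (λ v → ¬? (v ∈? η))
  ... | yes (v , _) = v
  ... | no _        = zero

  outside-∉ : ∀ {η v} → v ∉ η → outside η ∉ η
  outside-∉ {η} {v} v∉η with any? (λ v → ¬? (v ∈? η))
  ... | yes (_ , w∉η) = w∉η
  ... | no ¬outside   = ⊥-elim (¬outside (v , v∉η))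

  module InteriorColouring (c : Gr → Bool)
           (separated : ∀ x y → InInterior H G x → InInterior H G y →
                        c x ≡ true → c y ≡ false → ¬ (x ≼ y) × ¬ (y ≼ x)) where

    c-≼ : ∀ {x y} → InInterior H G x → InInterior H G y → x ≼ y → c x ≡ c y
    c-≼ {x} {y} ix iy x≼y = ≡-unless-true-false
      (λ cx cy → proj₁ (separated x y ix iy cx cy) x≼y)
      (λ cy cx → proj₂ (separated y x iy ix cy cx) x≼y)

    c-extension≡c-deletion : ∀ {f i u} → Emb H G f → Misses f i → Misses f u → i ≢ u →
                             c (G ⟨ i ∷ f ⟩) ≡ c (deleted u)
    c-extension≡c-deletion {f} {i} f-emb i∉f u∉f i≢u =
      c-≼ (extension-interior G 1+k<n f-emb i∉f) (deleted-interior f-emb u∉f)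
          (≼-deleted {G ⟨ i ∷ f ⟩} (induced-emb G (injective-∷ (proj₁ f-emb) i∉f))
                                   (misses-∷ i≢u u∉f))

    c-deletion-unique : ∀ {f u w} → Emb H G f → Misses f u → Misses f w →
                        c (deleted u) ≡ c (deleted w)
    c-deletion-unique {f} {u} {w} f-emb u∉f w∉f with <⇒misses 2+k<n (u ∷ w ∷ f)
    ... | i , i∉uwf = trans (≡.sym (c-extension≡c-deletion f-emb i∉f u∉f (≢-sym (i∉uwf zero))))
                            (c-extension≡c-deletion f-emb i∉f w∉f (≢-sym (i∉uwf (suc zero))))
      where
      i∉f : Misses f i
      i∉f x = i∉uwf (suc (suc x))

    χ : Subset (suc m) → Bool
    χ η = c (deleted (outside η))

    χ≡c-deletion : ∀ {η v} (o : Occ H G η) → v ∉ η → χ η ≡ c (deleted v)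
    χ≡c-deletion o v∉η = c-deletion-unique (occ-emb o)
      (∉⇒misses (occ-enumerates o) (outside-∉ v∉η)) (∉⇒misses (occ-enumerates o) v∉η)

    χ-absent : ∀ {η φ v} → Occ H G η → Occ H G φ → v ∉ η → v ∉ φ → χ η ≡ χ φ
    χ-absent oη oφ v∉η v∉φ = trans (χ≡c-deletion oη v∉η) (≡.sym (χ≡c-deletion oφ v∉φ))

    χ≡c-extension : ∀ {η i} (o : Occ H G η) → i ∉ η → χ η ≡ c (G ⟨ i ∷ proj₁ o ⟩)
    χ≡c-extension {i = i} o i∉η with <⇒misses 1+k<n (i ∷ proj₁ o)
    ... | u , u∉if =
      trans (χ≡c-deletion o (misses⇒∉ (occ-enumerates o) (u∉if ∘ suc)))
            (≡.sym (c-extension≡c-deletion (occ-emb o) (∉⇒misses (occ-enumerates o) i∉η)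
                                           (u∉if ∘ suc) (u∉if zero)))

    χ-InducedIso : ∀ {η φ i j} (oη : Occ H G η) (oφ : Occ H G φ) → i ∉ η → j ∉ φ →
                   InducedIso G (η ∪ ⁅ i ⁆) (φ ∪ ⁅ j ⁆) → χ η ≡ χ φ
    χ-InducedIso {i = i} {j} oη oφ i∉η j∉φ iso =
      trans (χ≡c-extension oη i∉η) (trans (c-≼ (interior oη i∉η) (interior oφ j∉φ) extη≼extφ)
                                          (≡.sym (χ≡c-extension oφ j∉φ)))
      where
      interior : ∀ {η i} (o : Occ H G η) → i ∉ η → InInterior H G (G ⟨ i ∷ proj₁ o ⟩)
      interior o i∉η = extension-interior G 1+k<n (occ-emb o) (∉⇒misses (occ-enumerates o) i∉η)
      ∷-occ-injective : ∀ {η i} (o : Occ H G η) → i ∉ η → Injective (i ∷ proj₁ o)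
      ∷-occ-injective o i∉η = injective-∷ (proj₁ (occ-emb o)) (∉⇒misses (occ-enumerates o) i∉η)
      extη≼extφ : G ⟨ i ∷ proj₁ oη ⟩ ≼ G ⟨ j ∷ proj₁ oφ ⟩
      extη≼extφ = InducedIso⇒≼ G
        (∷-enumerates (occ-enumerates oη)) (∷-occ-injective oη i∉η)
        (∷-enumerates (occ-enumerates oφ)) (∷-occ-injective oφ j∉φ) iso

    occurrence-below : ∀ {a} → InInterior H G a → ∃ λ η → Occ H G η × χ η ≡ c a
    occurrence-below {a} ia@((h , h-emb) , (e , e-emb) , a≇H , _)
      with ≇⇒misses (h , h-emb) (a≇H ∘ ≅-sym)
    ... | x , x∉h = image (e ∘ h) , o ,
      trans (χ≡c-extension o ex∉η) (c-≼ (extension-interior G 1+k<n eh-emb ex∉eh) ia ext≼a)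
      where
      eh-emb : Emb H G (e ∘ h)
      eh-emb = emb-∘ {H} {a} {G} e-emb h-emb
      o : Occ H G (image (e ∘ h))
      o = image-occ eh-emb
      ex∉eh : Misses (e ∘ h) (e x)
      ex∉eh = misses-∘ (proj₁ e-emb) x∉h
      ex∉η : e x ∉ image (e ∘ h)
      ex∉η = misses⇒∉ (image-enumerates (e ∘ h)) ex∉eh
      ext≼a : G ⟨ e x ∷ e ∘ h ⟩ ≼ a
      ext≼a = induced-≼ {a} G e-emb (injective-∷ (proj₁ h-emb) x∉h) (∷-cong refl (λ _ → refl))

  disconnected⇒stronglyZeroSplit : Disconnected H G → StronglyZeroSplit H G
  disconnected⇒stronglyZeroSplit (c , (a , ia , ca) , (b , ib , cb) , separated) =
    χ , (occurrence-true , occurrence-false , disjoint) , strong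
    where
    open InteriorColouring c separated

    occurrence-true : ∃[ η ] (Occ H G η × χ η ≡ true)
    occurrence-true = let η , o , χη≡ca = occurrence-below ia in η , o , trans χη≡ca ca

    occurrence-false : ∃[ φ ] (Occ H G φ × χ φ ≡ false)
    occurrence-false = let φ , o , χφ≡cb = occurrence-below ib in φ , o , trans χφ≡cb cb

    disjoint : ∀ η φ v → Occ H G η → Occ H G φ → χ η ≡ true → χ φ ≡ false →
               v ∉ η → v ∉ φ → ⊥
    disjoint _ _ _ oη oφ χη χφ v∉η v∉φ = ≡⇒¬true-false (χ-absent oη oφ v∉η v∉φ) χη χφ

    strong : ∀ η φ i j → Occ H G η → Occ H G φ → χ η ≡ true → χ φ ≡ false →
             i ∉ η → j ∉ φ → ¬ InducedIso G (η ∪ ⁅ i ⁆) (φ ∪ ⁅ j ⁆)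
    strong _ _ _ _ oη oφ χη χφ i∉η j∉φ iso =
      ≡⇒¬true-false (χ-InducedIso oη oφ i∉η j∉φ iso) χη χφ

-- From a strongly zero-split interval to a disconnected one

module _ (H G : Gr) (k+2<n : ∣ H ∣ᵍ + 2 < ∣ G ∣ᵍ) where

  open Occurrences H G

  private
    1+k<n : suc ∣ H ∣ᵍ < ∣ G ∣ᵍ
    1+k<n = ℕ.<-trans (ℕ.n<1+n _) (≡.subst (_< ∣ G ∣ᵍ) (ℕ.+-comm ∣ H ∣ᵍ 2) k+2<n)

  module OccurrenceColouring (χ : Subset ∣ G ∣ᵍ → Bool)
    (disjoint : ∀ η φ v → Occ H G η → Occ H G φ → χ η ≡ true → χ φ ≡ false → v ∉ η → v ∉ φ → ⊥)
    (strong : ∀ η φ i j → Occ H G η → Occ H G φ → χ η ≡ true → χ φ ≡ false →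
              i ∉ η → j ∉ φ → ¬ InducedIso G (η ∪ ⁅ i ⁆) (φ ∪ ⁅ j ⁆)) where

    TrueOccurrenceIn : Gr → Set
    TrueOccurrenceIn K = Σ (Fin ∣ K ∣ᵍ → Fin ∣ G ∣ᵍ) λ g → Emb K G g ×
                         Σ (Fin ∣ H ∣ᵍ → Fin ∣ K ∣ᵍ) λ h → Emb H K h × χ (image (g ∘ h)) ≡ true

    trueOccurrenceIn? : ∀ K → Dec (TrueOccurrenceIn K)
    trueOccurrenceIn? K = anyFunction? ∣ K ∣ᵍ
      (λ g≗g′ (g-emb , h , h-emb , χ≡true) →
         emb-resp {K} {G} g≗g′ g-emb , h , h-emb ,
         trans (cong χ (image-cong (≡.sym ∘ g≗g′ ∘ h))) χ≡true)
      λ g → emb? K G g ×-dec anyFunction? ∣ H ∣ᵍ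
        (λ h≗h′ (h-emb , χ≡true) →
           emb-resp {H} {K} h≗h′ h-emb , trans (cong χ (image-cong (cong g ∘ ≡.sym ∘ h≗h′))) χ≡true)
        λ h → emb? H K h ×-dec (χ (image (g ∘ h)) Bool.≟ true)

    colour : Gr → Bool
    colour K = does (trueOccurrenceIn? K)

    χ-independent-of-h : ∀ {K g h₁ h₂ u} → Emb K G g → Misses g u → Emb H K h₁ → Emb H K h₂ →
                         χ (image (g ∘ h₁)) ≡ χ (image (g ∘ h₂))
    χ-independent-of-h {K} {g} {h₁} {h₂} {u} g-emb u∉g h₁-emb h₂-emb = ≡-unless-true-false
      (λ t f → disjoint _ _ u (occ h₁-emb) (occ h₂-emb) t f (u∉ h₁) (u∉ h₂))
      (λ t f → disjoint _ _ u (occ h₂-emb) (occ h₁-emb) t f (u∉ h₂) (u∉ h₁))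
      where
      occ : ∀ {h} → Emb H K h → Occ H G (image (g ∘ h))
      occ h-emb = image-occ (emb-∘ {H} {K} {G} g-emb h-emb)
      u∉ : ∀ h → u ∉ image (g ∘ h)
      u∉ h = misses⇒∉ (image-enumerates (g ∘ h)) (u∉g ∘ h)

    χ-independent-of-g : ∀ {K g₁ g₂ h x} → Emb K G g₁ → Emb K G g₂ → Emb H K h → Misses h x →
                         χ (image (g₁ ∘ h)) ≡ χ (image (g₂ ∘ h))
    χ-independent-of-g {K} {g₁} {g₂} {h} {x} g₁-emb g₂-emb h-emb x∉h = ≡-unless-true-false
      (λ t f → strong _ _ _ _ (occ g₁-emb) (occ g₂-emb) t f (gx∉ g₁-emb) (gx∉ g₂-emb)
                      (iso g₁-emb g₂-emb))
      (λ t f → strong _ _ _ _ (occ g₂-emb) (occ g₁-emb) t f (gx∉ g₂-emb) (gx∉ g₁-emb)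
                      (iso g₂-emb g₁-emb))
      where
      occ : ∀ {g} → Emb K G g → Occ H G (image (g ∘ h))
      occ g-emb = image-occ (emb-∘ {H} {K} {G} g-emb h-emb)
      gx∉ : ∀ {g} → Emb K G g → g x ∉ image (g ∘ h)
      gx∉ (g-inj , _) = misses⇒∉ (image-enumerates _) (misses-∘ g-inj x∉h)
      -- image (g ∘ (x ∷ h)) unfolds to image (g ∘ h) ∪ ⁅ g x ⁆
      iso : ∀ {g g′} → Emb K G g → Emb K G g′ →
            InducedIso G (image (g ∘ h) ∪ ⁅ g x ⁆) (image (g′ ∘ h) ∪ ⁅ g′ x ⁆)
      iso (g-inj , g-adj) (g′-inj , g′-adj) = sameInduced⇒InducedIso G
        (injective-∘ g-inj x∷h-inj) (injective-∘ g′-inj x∷h-inj)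
        λ _ _ → trans (≡.sym (g-adj _ _)) (g′-adj _ _)
        where
        x∷h-inj : Injective (x ∷ h)
        x∷h-inj = injective-∷ (proj₁ h-emb) x∉h

    χ-independent : ∀ {K g₁ g₂ h₁ h₂} → InInterior H G K →
                    Emb K G g₁ → Emb K G g₂ → Emb H K h₁ → Emb H K h₂ →
                    χ (image (g₁ ∘ h₁)) ≡ χ (image (g₂ ∘ h₂))
    χ-independent {K} (_ , _ , K≇H , K≇G) g₁-emb g₂-emb h₁-emb h₂-emb
      with ≇⇒misses (_ , g₂-emb) K≇G | ≇⇒misses (_ , h₁-emb) (K≇H ∘ ≅-sym)
    ... | u , u∉g₂ | x , x∉h₁ = trans (χ-independent-of-g {K} g₁-emb g₂-emb h₁-emb x∉h₁)
                                      (χ-independent-of-h {K} g₂-emb u∉g₂ h₁-emb h₂-emb)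

    colour≡χ : ∀ {K g h} → InInterior H G K → Emb K G g → Emb H K h → colour K ≡ χ (image (g ∘ h))
    colour≡χ {K} {g} {h} iK g-emb h-emb with trueOccurrenceIn? K
    ... | yes (g′ , g′-emb , h′ , h′-emb , χ≡true) =
      trans (≡.sym χ≡true) (χ-independent {K} iK g′-emb g-emb h′-emb h-emb)
    ... | no ¬true = ≡.sym (Bool.¬-not λ χ≡true → ¬true (g , g-emb , h , h-emb , χ≡true))

    colour-≼ : ∀ {x y} → InInterior H G x → InInterior H G y → x ≼ y → colour x ≡ colour y
    colour-≼ {x} {y} ix@((_ , hx-emb) , _) iy@(_ , (_ , gy-emb) , _) (_ , e-emb) =
      trans (colour≡χ {x} ix (emb-∘ {x} {y} {G} gy-emb e-emb) hx-emb)
            (≡.sym (colour≡χ {y} iy gy-emb (emb-∘ {H} {x} {y} e-emb hx-emb)))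

    interior-above : ∀ {η} → Occ H G η → ∃ λ a → InInterior H G a × colour a ≡ χ η
    interior-above o with <⇒misses (ℕ.<-trans (ℕ.n<1+n _) 1+k<n) (proj₁ o)
    ... | i , i∉f = G ⟨ i ∷ proj₁ o ⟩ , interior ,
      trans (colour≡χ interior (induced-emb G (injective-∷ (proj₁ (occ-emb o)) i∉f))
                               (suc-emb {H} G {i = i} (occ-emb o)))
            (cong χ (enumerates⇒image≡ (occ-enumerates o)))
      where
      interior : InInterior H G (G ⟨ i ∷ proj₁ o ⟩)
      interior = extension-interior G 1+k<n (occ-emb o) i∉f

  stronglyZeroSplit⇒disconnected : StronglyZeroSplit H G → Disconnected H G
  stronglyZeroSplit⇒disconnected (χ , ((η , oη , χη) , (φ , oφ , χφ) , disjoint) , strong) =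
    colour , interior-true , interior-false , separated
    where
    open OccurrenceColouring χ disjoint strong

    interior-true : ∃[ a ] (InInterior H G a × colour a ≡ true)
    interior-true = let a , ia , ca≡χη = interior-above oη in a , ia , trans ca≡χη χη

    interior-false : ∃[ b ] (InInterior H G b × colour b ≡ false)
    interior-false = let b , ib , cb≡χφ = interior-above oφ in b , ib , trans cb≡χφ χφ

    separated : ∀ x y → InInterior H G x → InInterior H G y → colour x ≡ true → colour y ≡ false →
                ¬ (x ≼ y) × ¬ (y ≼ x)
    separated _ _ ix iy cx cy = (λ x≼y → ≡⇒¬true-false (colour-≼ ix iy x≼y) cx cy)
                              , (λ y≼x → ≡⇒¬true-false (≡.sym (colour-≼ iy ix y≼x)) cx cy)

theorem2p3 : (H G : Gr) → H ≼ G → ∣ H ∣ᵍ + 2 < ∣ G ∣ᵍ →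
    (Disconnected H G ⇔ StronglyZeroSplit H G)
theorem2p3 H (zero , _) _ ()
theorem2p3 H G@(suc m , g) _ k+2<n =
  mk⇔ (disconnected⇒stronglyZeroSplit H g k+2<n) (stronglyZeroSplit⇒disconnected H G k+2<n)
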